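{- Let $\mathcal{C}$ be a hyper-extensive category and $H$ an endofunctor on $\mathcal{C}$ having a terminal coalgebra and preserving countable coproducts. Then for every object $Y$ of $\mathcal{C}$ the functor $H(-)+Y$ is a cia functor.
   Context: Hyper-extensive: countable coproducts exist and are universal (stable under pullback along any morphism), disjoint (injections monic, distinct injections have pullback the initial object), and coherent (a copairing of countably many pairwise disjoint coproduct injections into an object is a coproduct injection). For an endofunctor $G$, a $G$-algebra $a\colon GA\to A$ is corecursive if for every coalgebra $e\colon X\to GX$ there is a unique $e^\dagger\colon X\to A$ with $e^\dagger=a\cdot Ge^\dagger\cdot e$; it is a cia if for every $e\colon X\to GX+A$ there is a unique $e^\dagger\colon X\to A$ with $e^\dagger=[a,\mathrm{id}_A]\cdot(Ge^\dagger+\mathrm{id}_A)\cdot e$. $G$ is a cia functor if every corecursive $G$-algebra is a cia. -}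

module Defs where

open import Level using (Level; _⊔_) renaming (suc to lsuc)
open import Data.Nat using (ℕ; zero; suc)
open import Data.Bool using (Bool; true; false)
open import Data.Product using (Σ; _×_; _,_; proj₁; proj₂)
open import Function.Definitions using (Injective)
open import Relation.Binary.PropositionalEquality using (_≡_; _≢_) renaming (refl to ≡-refl)
open import Relation.Binary.Structures using (IsEquivalence)
open import Relation.Binary.Bundles using (Setoid)

record Category (o ℓ e : Level) : Set (lsuc (o ⊔ ℓ ⊔ e)) where
  infix  4 _≈_ _⇒_
  infixr 9 _∘_
  field
    Obj       : Set o
    _⇒_       : Obj → Obj → Set ℓ
    _≈_       : ∀ {A B} → A ⇒ B → A ⇒ B → Set e
    id        : ∀ {A} → A ⇒ A
    _∘_       : ∀ {A B D} → B ⇒ D → A ⇒ B → A ⇒ D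
    equiv     : ∀ {A B} → IsEquivalence (_≈_ {A} {B})
    assoc     : ∀ {A B D E} {f : A ⇒ B} {g : B ⇒ D} {h : D ⇒ E} →
                (h ∘ g) ∘ f ≈ h ∘ (g ∘ f)
    identityˡ : ∀ {A B} {f : A ⇒ B} → id ∘ f ≈ f
    identityʳ : ∀ {A B} {f : A ⇒ B} → f ∘ id ≈ f
    ∘-resp-≈  : ∀ {A B D} {f h : B ⇒ D} {g i : A ⇒ B} →
                f ≈ h → g ≈ i → f ∘ g ≈ h ∘ i

  hom-setoid : Obj → Obj → Setoid ℓ e
  hom-setoid A B = record { Carrier = A ⇒ B ; _≈_ = _≈_ ; isEquivalence = equiv }

  module Equiv {A B : Obj} = IsEquivalence (equiv {A} {B})

record Endofunctor {o ℓ e : Level} (C : Category o ℓ e) : Set (o ⊔ ℓ ⊔ e) where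
  open Category C
  field
    F₀           : Obj → Obj
    F₁           : ∀ {A B} → A ⇒ B → F₀ A ⇒ F₀ B
    identity     : ∀ {A} → F₁ (id {A}) ≈ id
    homomorphism : ∀ {A B D} {f : A ⇒ B} {g : B ⇒ D} → F₁ (g ∘ f) ≈ F₁ g ∘ F₁ f
    F-resp-≈     : ∀ {A B} {f g : A ⇒ B} → f ≈ g → F₁ f ≈ F₁ g

Countable : Set → Set
Countable I = Σ (I → ℕ) λ f → Injective _≡_ _≡_ f

Bool-countable : Countable Bool
Bool-countable = code , inj
  where
  code : Bool → ℕ
  code true  = 0
  code false = 1
  inj : Injective _≡_ _≡_ code
  inj {true}  {true}  _ = ≡-refl
  inj {false} {false} _ = ≡-refl
  inj {true}  {false} ()
  inj {false} {true}  ()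

module _ {o ℓ e : Level} (C : Category o ℓ e) where
  open Category C

  IsInitial : Obj → Set (o ⊔ ℓ ⊔ e)
  IsInitial Z = ∀ X → Σ (Z ⇒ X) λ ! → ∀ (g : Z ⇒ X) → g ≈ !

  Monic : ∀ {A B} → A ⇒ B → Set (o ⊔ ℓ ⊔ e)
  Monic {A} m = ∀ {X} (g h : X ⇒ A) → m ∘ g ≈ m ∘ h → g ≈ h

  IsPullback : ∀ {P A B D} → P ⇒ A → P ⇒ B → A ⇒ D → B ⇒ D → Set (o ⊔ ℓ ⊔ e)
  IsPullback {P} {A} {B} p₁ p₂ f g =
    (f ∘ p₁ ≈ g ∘ p₂) ×
    (∀ {Q} (q₁ : Q ⇒ A) (q₂ : Q ⇒ B) → f ∘ q₁ ≈ g ∘ q₂ →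
       Σ (Q ⇒ P) λ u → (p₁ ∘ u ≈ q₁) × (p₂ ∘ u ≈ q₂) ×
         (∀ (v : Q ⇒ P) → p₁ ∘ v ≈ q₁ → p₂ ∘ v ≈ q₂ → v ≈ u))

  IsCoproduct : {I : Set} (A : I → Obj) (P : Obj) → (∀ i → A i ⇒ P) → Set (o ⊔ ℓ ⊔ e)
  IsCoproduct {I} A P ι =
    ∀ {X} (f : ∀ i → A i ⇒ X) →
      Σ (P ⇒ X) λ h → (∀ i → h ∘ ι i ≈ f i) ×
        (∀ (k : P ⇒ X) → (∀ i → k ∘ ι i ≈ f i) → k ≈ h)

  record Coproduct {I : Set} (A : I → Obj) : Set (o ⊔ ℓ ⊔ e) where
    field
      obj         : Obj
      inj         : ∀ i → A i ⇒ obj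
      isCoproduct : IsCoproduct A obj inj

  fam2 : Obj → Obj → Bool → Obj
  fam2 A B true  = A
  fam2 A B false = B

  cocone2 : ∀ {A B D} → A ⇒ D → B ⇒ D → (b : Bool) → fam2 A B b ⇒ D
  cocone2 f g true  = f
  cocone2 f g false = g

  IsCoproductInjection : ∀ {A B} → A ⇒ B → Set (o ⊔ ℓ ⊔ e)
  IsCoproductInjection {A} {B} m =
    Σ Obj λ D → Σ (D ⇒ B) λ n → IsCoproduct (fam2 A D) B (cocone2 m n)

  Disjoint : ∀ {A B P} → A ⇒ P → B ⇒ P → Set (o ⊔ ℓ ⊔ e)
  Disjoint {A} {B} m n =
    ∀ Z (isI : IsInitial Z) → IsPullback (proj₁ (isI A)) (proj₁ (isI B)) m n

record HyperExtensive {o ℓ e : Level} (C : Category o ℓ e) : Set (lsuc Level.zero ⊔ o ⊔ ℓ ⊔ e) where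
  open Category C
  field
    coproducts : ∀ {I : Set} → Countable I → (A : I → Obj) → Coproduct C A
    pullback-inj : ∀ {I : Set} → Countable I → {A : I → Obj} {P : Obj}
                   {ι : ∀ i → A i ⇒ P} → IsCoproduct C A P ι →
                   ∀ {B} (f : B ⇒ P) (i : I) →
                   Σ Obj λ Q → Σ (Q ⇒ B) λ p → Σ (Q ⇒ A i) λ q → IsPullback C p q f (ι i)
    universal : ∀ {I : Set} → Countable I → {A : I → Obj} {P : Obj}
                {ι : ∀ i → A i ⇒ P} → IsCoproduct C A P ι →
                ∀ {B} (f : B ⇒ P) (Bs : I → Obj) (p : ∀ i → Bs i ⇒ B)
                (q : ∀ i → Bs i ⇒ A i) → (∀ i → IsPullback C (p i) (q i) f (ι i)) →
                IsCoproduct C Bs B p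
    inj-monic : ∀ {I : Set} → Countable I → {A : I → Obj} {P : Obj}
                {ι : ∀ i → A i ⇒ P} → IsCoproduct C A P ι → ∀ i → Monic C (ι i)
    disjoint  : ∀ {I : Set} → Countable I → {A : I → Obj} {P : Obj}
                {ι : ∀ i → A i ⇒ P} → IsCoproduct C A P ι →
                ∀ i j → i ≢ j → Disjoint C (ι i) (ι j)
    coherent  : ∀ {I : Set} → Countable I → {B : Obj} {A : I → Obj}
                (m : ∀ i → A i ⇒ B) → (∀ i → IsCoproductInjection C (m i)) →
                (∀ i j → i ≢ j → Disjoint C (m i) (m j)) →
                ∀ {P} {ι : ∀ i → A i ⇒ P} (c : IsCoproduct C A P ι) →
                IsCoproductInjection C (proj₁ (c m))

module _ {o ℓ e : Level} (C : Category o ℓ e) (HE : HyperExtensive C) where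
  open Category C
  open HyperExtensive HE

  infixr 6 _+_
  _+_ : Obj → Obj → Obj
  A + B = Coproduct.obj (coproducts Bool-countable (fam2 C A B))

  ι₁ : ∀ {A B} → A ⇒ A + B
  ι₁ {A} {B} = Coproduct.inj (coproducts Bool-countable (fam2 C A B)) true

  ι₂ : ∀ {A B} → B ⇒ A + B
  ι₂ {A} {B} = Coproduct.inj (coproducts Bool-countable (fam2 C A B)) false

  +-isCoproduct : ∀ {A B} → IsCoproduct C (fam2 C A B) (A + B) (cocone2 C ι₁ ι₂)
  +-isCoproduct {A} {B} f = h , comm , uniq
    where
    cp = Coproduct.isCoproduct (coproducts Bool-countable (fam2 C A B)) f
    h = proj₁ cp
    comm : ∀ b → h ∘ cocone2 C ι₁ ι₂ b ≈ f b
    comm true  = proj₁ (proj₂ cp) true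
    comm false = proj₁ (proj₂ cp) false
    uniq : ∀ k → (∀ b → k ∘ cocone2 C ι₁ ι₂ b ≈ f b) → k ≈ h
    uniq k eq = proj₂ (proj₂ cp) k λ { true → eq true ; false → eq false }

  [_,_] : ∀ {A B D} → A ⇒ D → B ⇒ D → A + B ⇒ D
  [ f , g ] = proj₁ (+-isCoproduct (cocone2 C f g))

  infixr 6 _+₁_
  _+₁_ : ∀ {A B A' B'} → A ⇒ A' → B ⇒ B' → A + B ⇒ A' + B'
  f +₁ g = [ ι₁ ∘ f , ι₂ ∘ g ]

  module _ (G : Endofunctor C) where
    open Endofunctor G

    IsCorecursive : ∀ {A} → F₀ A ⇒ A → Set (o ⊔ ℓ ⊔ e)
    IsCorecursive {A} a =
      ∀ {X} (c : X ⇒ F₀ X) →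
        Σ (X ⇒ A) λ s → (s ≈ a ∘ F₁ s ∘ c) ×
          (∀ (s' : X ⇒ A) → s' ≈ a ∘ F₁ s' ∘ c → s' ≈ s)

    IsCia : ∀ {A} → F₀ A ⇒ A → Set (o ⊔ ℓ ⊔ e)
    IsCia {A} a =
      ∀ {X} (c : X ⇒ F₀ X + A) →
        Σ (X ⇒ A) λ s → (s ≈ [ a , id ] ∘ (F₁ s +₁ id) ∘ c) ×
          (∀ (s' : X ⇒ A) → s' ≈ [ a , id ] ∘ (F₁ s' +₁ id) ∘ c → s' ≈ s)

    IsCiaFunctor : Set (o ⊔ ℓ ⊔ e)
    IsCiaFunctor = ∀ {A} (a : F₀ A ⇒ A) → IsCorecursive a → IsCia a

  _+K_ : Endofunctor C → Obj → Endofunctor C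
  H +K Y = record
    { F₀ = λ X → H.F₀ X + Y
    ; F₁ = λ f → H.F₁ f +₁ id
    ; identity = ident
    ; homomorphism = homo
    ; F-resp-≈ = resp
    }
    where
    module H = Endofunctor H
    open Equiv
    uniq : ∀ {A B D} (f : A ⇒ D) (g : B ⇒ D) (k : A + B ⇒ D) →
           k ∘ ι₁ ≈ f → k ∘ ι₂ ≈ g → k ≈ [ f , g ]
    uniq f g k p q = proj₂ (proj₂ (+-isCoproduct (cocone2 C f g))) k
                       λ { true → p ; false → q }
    β₁ : ∀ {A B D} {f : A ⇒ D} {g : B ⇒ D} → [ f , g ] ∘ ι₁ ≈ f
    β₁ {f = f} {g} = proj₁ (proj₂ (+-isCoproduct (cocone2 C f g))) true
    β₂ : ∀ {A B D} {f : A ⇒ D} {g : B ⇒ D} → [ f , g ] ∘ ι₂ ≈ g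
    β₂ {f = f} {g} = proj₁ (proj₂ (+-isCoproduct (cocone2 C f g))) false

    ident : ∀ {A} → H.F₁ (id {A}) +₁ id {Y} ≈ id
    ident = sym (uniq _ _ id
      (trans identityˡ (sym (trans (∘-resp-≈ refl H.identity) identityʳ)))
      (trans identityˡ (sym identityʳ)))

    homo : ∀ {A B D} {f : A ⇒ B} {g : B ⇒ D} →
           H.F₁ (g ∘ f) +₁ id {Y} ≈ (H.F₁ g +₁ id) ∘ (H.F₁ f +₁ id)
    homo {f = f} {g} = sym (uniq _ _ _
      (trans assoc (trans (∘-resp-≈ refl β₁) (trans (sym assoc)
        (trans (∘-resp-≈ β₁ refl) (trans assoc
          (∘-resp-≈ refl (sym H.homomorphism)))))))
      (trans assoc (trans (∘-resp-≈ refl β₂) (trans (sym assoc)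
        (trans (∘-resp-≈ β₂ refl) (trans assoc
          (∘-resp-≈ refl identityˡ)))))))

    resp : ∀ {A B} {f g : A ⇒ B} → f ≈ g → H.F₁ f +₁ id {Y} ≈ H.F₁ g +₁ id
    resp p = uniq _ _ _ (trans β₁ (∘-resp-≈ refl (H.F-resp-≈ p))) β₂

module _ {o ℓ e : Level} (C : Category o ℓ e) (H : Endofunctor C) where
  open Category C
  open Endofunctor H

  HasTerminalCoalgebra : Set (o ⊔ ℓ ⊔ e)
  HasTerminalCoalgebra =
    Σ Obj λ T → Σ (T ⇒ F₀ T) λ τ →
      ∀ {X} (c : X ⇒ F₀ X) →
        Σ (X ⇒ T) λ h → (τ ∘ h ≈ F₁ h ∘ c) ×
          (∀ (h' : X ⇒ T) → τ ∘ h' ≈ F₁ h' ∘ c → h' ≈ h)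

  PreservesCountableCoproducts : Set (lsuc Level.zero ⊔ o ⊔ ℓ ⊔ e)
  PreservesCountableCoproducts =
    ∀ {I : Set} → Countable I → {A : I → Obj} {P : Obj} {ι : ∀ i → A i ⇒ P} →
      IsCoproduct C A P ι → IsCoproduct C (λ i → F₀ (A i)) (F₀ P) (λ i → F₁ (ι i))

-- Fix a corecursive algebra a : HA + Y → A and an equation ε : X → (HX + Y) + A,
-- and call layer n the part of X from which ε reaches A in exactly n + 1 steps.
-- Layers are cut out inductively: if X = L + R with L the points reaching A within
-- n steps, then HX = HL + HR, so (HX + Y) + A regroups as (HL + A) + (HR + Y), and
-- pulling ε back along this coproduct splits R into the next layer and the rest;
-- on the new layer the solution is forced by its values on L. The layers are
-- pairwise disjoint coproduct injections, so by coherence their copairing has a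
-- complement X∞. No point of X∞ reaches HL + A for any stage L: since H preserves
-- the countable coproduct of the layers, such a point would lie in a layer. Hence
-- ε restricts to a coalgebra X∞ → HX∞ + Y, where corecursiveness of a gives the
-- unique solution, and the two parts glue to the unique solution on X.

module Submission where

open import Level using (Level; _⊔_)
open import Data.Nat using (ℕ; zero; suc; _<_; _≤′_; ≤′-refl; ≤′-step)
open import Data.Nat.Properties using (<-cmp; ≤⇒≤′)
open import Data.Bool using (Bool; true; false)
open import Data.Empty using (⊥; ⊥-elim)
open import Data.Product using (Σ; _×_; _,_; proj₁; proj₂)
open import Relation.Binary.Definitions using (Tri; tri<; tri≈; tri>)
open import Relation.Binary.PropositionalEquality using (_≡_; _≢_)
import Relation.Binary.Reasoning.Setoid as SetoidReasoning
open import Defs hiding (_+_; ι₁; ι₂; [_,_]; _+₁_)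
import Defs as D

ℕ-countable : Countable ℕ
ℕ-countable = (λ n → n) , λ n≡m → n≡m

⊥-countable : Countable ⊥
⊥-countable = (λ ()) , λ {x} → ⊥-elim x

module CategoryReasoning {o ℓ e : Level} (C : Category o ℓ e) where
  open Category C
  open Equiv public

  module _ {A B : Obj} where
    open SetoidReasoning (hom-setoid A B) public

  infixr 4 _⟩∘⟨_
  _⟩∘⟨_ : ∀ {A B D} {f h : B ⇒ D} {g i : A ⇒ B} → f ≈ h → g ≈ i → f ∘ g ≈ h ∘ i
  _⟩∘⟨_ = ∘-resp-≈

  refl⟩∘⟨_ : ∀ {A B D} {f : B ⇒ D} {g i : A ⇒ B} → g ≈ i → f ∘ g ≈ f ∘ i
  refl⟩∘⟨ p = ∘-resp-≈ refl p

  _⟩∘⟨refl : ∀ {A B D} {f h : B ⇒ D} {g : A ⇒ B} → f ≈ h → f ∘ g ≈ h ∘ g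
  p ⟩∘⟨refl = ∘-resp-≈ p refl

  sym-assoc : ∀ {A B D E} {f : A ⇒ B} {g : B ⇒ D} {h : D ⇒ E} →
              h ∘ (g ∘ f) ≈ (h ∘ g) ∘ f
  sym-assoc = sym assoc

  pullˡ : ∀ {A B D E} {a : D ⇒ E} {b : B ⇒ D} {c : B ⇒ E} {f : A ⇒ B} →
          a ∘ b ≈ c → a ∘ (b ∘ f) ≈ c ∘ f
  pullˡ p = trans sym-assoc (p ⟩∘⟨refl)

  pullʳ : ∀ {A B D E} {a : D ⇒ E} {b : B ⇒ D} {f : A ⇒ B} {g : A ⇒ D} →
          b ∘ f ≈ g → (a ∘ b) ∘ f ≈ a ∘ g
  pullʳ p = trans assoc (refl⟩∘⟨ p)

  pull-through : ∀ {U V W Z} {k : V ⇒ Z} {g : W ⇒ V} {c : U ⇒ V} {i : W ⇒ U} {kc : U ⇒ Z} →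
                 c ∘ i ≈ g → k ∘ c ≈ kc → k ∘ g ≈ kc ∘ i
  pull-through ci≈g kc≈ = trans (refl⟩∘⟨ sym ci≈g) (trans sym-assoc (kc≈ ⟩∘⟨refl))

module Coproducts {o ℓ e : Level} (C : Category o ℓ e) where
  open Category C
  open CategoryReasoning C

  IsBinaryCoproduct : ∀ {A B} (P : Obj) → A ⇒ P → B ⇒ P → Set (o ⊔ ℓ ⊔ e)
  IsBinaryCoproduct {A} {B} P i j = IsCoproduct C (fam2 C A B) P (cocone2 C i j)

  module BinaryCoproduct {A B P : Obj} {i : A ⇒ P} {j : B ⇒ P}
                         (isCoproduct : IsBinaryCoproduct P i j) where
    copair : ∀ {Z} → A ⇒ Z → B ⇒ Z → P ⇒ Z
    copair f g = proj₁ (isCoproduct (cocone2 C f g))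

    inject₁ : ∀ {Z} {f : A ⇒ Z} {g : B ⇒ Z} → copair f g ∘ i ≈ f
    inject₁ {f = f} {g} = proj₁ (proj₂ (isCoproduct (cocone2 C f g))) true

    inject₂ : ∀ {Z} {f : A ⇒ Z} {g : B ⇒ Z} → copair f g ∘ j ≈ g
    inject₂ {f = f} {g} = proj₁ (proj₂ (isCoproduct (cocone2 C f g))) false

    unique : ∀ {Z} {f : A ⇒ Z} {g : B ⇒ Z} (h : P ⇒ Z) →
             h ∘ i ≈ f → h ∘ j ≈ g → h ≈ copair f g
    unique {f = f} {g} h hi≈f hj≈g =
      proj₂ (proj₂ (isCoproduct (cocone2 C f g))) h λ { true → hi≈f ; false → hj≈g }

    unique′ : ∀ {Z} {h h′ : P ⇒ Z} → h ∘ i ≈ h′ ∘ i → h ∘ j ≈ h′ ∘ j → h ≈ h′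
    unique′ {h = h} {h′} hi≈h′i hj≈h′j = trans (unique h hi≈h′i hj≈h′j) (sym (unique h′ refl refl))

  Bool-coproduct⇒binary : ∀ {A : Bool → Obj} {P} {ι : ∀ b → A b ⇒ P} →
                          IsCoproduct C A P ι → IsBinaryCoproduct P (ι true) (ι false)
  Bool-coproduct⇒binary {A} {P} {ι} isCoproduct {Z} f = h , commutes , unique
    where
    f′ : ∀ b → A b ⇒ Z
    f′ true  = f true
    f′ false = f false
    h : P ⇒ Z
    h = proj₁ (isCoproduct f′)
    commutes : ∀ b → h ∘ cocone2 C (ι true) (ι false) b ≈ f b
    commutes true  = proj₁ (proj₂ (isCoproduct f′)) true
    commutes false = proj₁ (proj₂ (isCoproduct f′)) false
    unique : ∀ k → (∀ b → k ∘ cocone2 C (ι true) (ι false) b ≈ f b) → k ≈ h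
    unique k eq = proj₂ (proj₂ (isCoproduct f′)) k λ { true → eq true ; false → eq false }

  binary-swap : ∀ {A B P} {i : A ⇒ P} {j : B ⇒ P} →
                IsBinaryCoproduct P i j → IsBinaryCoproduct P j i
  binary-swap {i = i} {j} isCoproduct f = copair (f false) (f true) , commutes , unique-swapped
    where
    open BinaryCoproduct isCoproduct
    commutes : ∀ b → copair (f false) (f true) ∘ cocone2 C j i b ≈ f b
    commutes true  = inject₂
    commutes false = inject₁
    unique-swapped : ∀ k → (∀ b → k ∘ cocone2 C j i b ≈ f b) → k ≈ copair (f false) (f true)
    unique-swapped k eq = unique k (eq false) (eq true)

  coproduct-ext : ∀ {I : Set} {A : I → Obj} {P} {ι : ∀ i → A i ⇒ P} → IsCoproduct C A P ι →
                  ∀ {Z} {h h′ : P ⇒ Z} → (∀ i → h ∘ ι i ≈ h′ ∘ ι i) → h ≈ h′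
  coproduct-ext {ι = ι} isCoproduct {h = h} {h′} hι≈h′ι =
    trans (proj₂ (proj₂ (isCoproduct (λ i → h′ ∘ ι i))) h hι≈h′ι)
          (sym (proj₂ (proj₂ (isCoproduct (λ i → h′ ∘ ι i))) h′ λ _ → refl))

  initial-≈ : ∀ {Q X} → IsInitial C Q → (f g : Q ⇒ X) → f ≈ g
  initial-≈ {X = X} isInitial f g =
    trans (proj₂ (isInitial X) f) (sym (proj₂ (isInitial X) g))

  coproduct-of-initials : ∀ {I : Set} {A : I → Obj} {P} {ι : ∀ i → A i ⇒ P} →
                          IsCoproduct C A P ι → (∀ i → IsInitial C (A i)) → IsInitial C P
  coproduct-of-initials {A = A} {ι = ι} isCoproduct initial X =
    proj₁ (isCoproduct from-summands) ,
    λ g → proj₂ (proj₂ (isCoproduct from-summands)) g λ i → proj₂ (initial i X) (g ∘ ι i)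
    where
    from-summands : ∀ i → A i ⇒ X
    from-summands i = proj₁ (initial i X)

  initial-left-unit : ∀ {Z X} (isInitial : IsInitial C Z) →
                      IsBinaryCoproduct X (proj₁ (isInitial X)) id
  initial-left-unit isInitial f = f false , commutes , λ k eq → trans (sym identityʳ) (eq false)
    where
    commutes : ∀ b → f false ∘ cocone2 C (proj₁ (isInitial _)) id b ≈ f b
    commutes true  = initial-≈ isInitial _ _
    commutes false = identityʳ

  Apart : ∀ {A B D} → A ⇒ D → B ⇒ D → Set (o ⊔ ℓ ⊔ e)
  Apart {A} {B} f g = ∀ {Q} (y : Q ⇒ A) (z : Q ⇒ B) → f ∘ y ≈ g ∘ z → IsInitial C Q

  Apart-sym : ∀ {A B D} {f : A ⇒ D} {g : B ⇒ D} → Apart f g → Apart g f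
  Apart-sym apart y z gy≈fz = apart z y (sym gy≈fz)

  Apart-∘ : ∀ {A B A′ B′ D} {f : A ⇒ D} {g : B ⇒ D} {f′ : A′ ⇒ D} {g′ : B′ ⇒ D}
            {u : A′ ⇒ A} {v : B′ ⇒ B} →
            Apart f g → f ∘ u ≈ f′ → g ∘ v ≈ g′ → Apart f′ g′
  Apart-∘ {f = f} {g} {f′} {g′} {u} {v} apart fu≈f′ gv≈g′ y z f′y≈g′z =
    apart (u ∘ y) (v ∘ z) (begin
      f ∘ (u ∘ y)   ≈⟨ pullˡ fu≈f′ ⟩
      f′ ∘ y        ≈⟨ f′y≈g′z ⟩
      g′ ∘ z        ≈⟨ sym (pullˡ gv≈g′) ⟩
      g ∘ (v ∘ z)   ∎)

  Apart⇒Disjoint : ∀ {A B D} {f : A ⇒ D} {g : B ⇒ D} → Apart f g → Disjoint C f g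
  Apart⇒Disjoint apart Z isInitial = initial-≈ isInitial _ _ , λ q₁ q₂ square →
    let isQ = apart q₁ q₂ square
    in proj₁ (isQ Z) , initial-≈ isQ _ _ , initial-≈ isQ _ _ , λ _ _ _ → initial-≈ isQ _ _

module Extensive {o ℓ e : Level} (C : Category o ℓ e) (HE : HyperExtensive C) where
  open Category C
  open HyperExtensive HE
  open CategoryReasoning C
  open Coproducts C

  empty-coproduct : Coproduct C {⊥} ⊥-elim
  empty-coproduct = coproducts ⊥-countable ⊥-elim

  𝟘 : Obj
  𝟘 = Coproduct.obj empty-coproduct

  𝟘-isInitial : IsInitial C 𝟘
  𝟘-isInitial X = proj₁ (Coproduct.isCoproduct empty-coproduct (λ ())) ,
                  λ g → proj₂ (proj₂ (Coproduct.isCoproduct empty-coproduct (λ ()))) g (λ ())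

  -- An initial object is the coproduct of the empty family, and universality
  -- pulls that coproduct back along any morphism into it.
  initial-strict : ∀ {Z Q} → IsInitial C Z → Q ⇒ Z → IsInitial C Q
  initial-strict {Z} {Q} isInitial f X =
    proj₁ (Q-empty (λ ())) , λ g → proj₂ (proj₂ (Q-empty (λ ()))) g (λ ())
    where
    Z-empty : IsCoproduct C {⊥} (λ ()) Z (λ ())
    Z-empty _ = proj₁ (isInitial _) , (λ ()) , λ k _ → proj₂ (isInitial _) k
    Q-empty : IsCoproduct C {⊥} (λ ()) Q (λ ())
    Q-empty = universal ⊥-countable Z-empty f (λ ()) (λ ()) (λ ()) (λ ())

  Disjoint⇒Apart : ∀ {A B D} {f : A ⇒ D} {g : B ⇒ D} → Disjoint C f g → Apart f g
  Disjoint⇒Apart disjoint y z square =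
    initial-strict 𝟘-isInitial (proj₁ (proj₂ (disjoint 𝟘 𝟘-isInitial) y z square))

  record Decomposition {I : Set} {A : I → Obj} {P B : Obj} (ι : ∀ i → A i ⇒ P) (f : B ⇒ P)
                       : Set (o ⊔ ℓ ⊔ e) where
    field
      part        : I → Obj
      p           : ∀ i → part i ⇒ B
      q           : ∀ i → part i ⇒ A i
      pullback    : ∀ i → IsPullback C (p i) (q i) f (ι i)
      isCoproduct : IsCoproduct C part B p

  decompose : ∀ {I : Set} → Countable I → {A : I → Obj} {P : Obj} {ι : ∀ i → A i ⇒ P} →
              IsCoproduct C A P ι → ∀ {B} (f : B ⇒ P) → Decomposition ι f
  decompose countable {A} {ι = ι} P-isCoproduct {B} f = record
    { part = λ i → proj₁ (pulled i)
    ; p = λ i → proj₁ (proj₂ (pulled i))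
    ; q = λ i → proj₁ (proj₂ (proj₂ (pulled i)))
    ; pullback = λ i → proj₂ (proj₂ (proj₂ (pulled i)))
    ; isCoproduct = universal countable P-isCoproduct f _ _ _ λ i → proj₂ (proj₂ (proj₂ (pulled i)))
    }
    where
    pulled : ∀ i → Σ Obj λ Q → Σ (Q ⇒ B) λ p → Σ (Q ⇒ A i) λ q → IsPullback C p q f (ι i)
    pulled = pullback-inj countable P-isCoproduct f

  Apart-copair : ∀ {I : Set} → Countable I → {A : I → Obj} {P : Obj} {ι : ∀ i → A i ⇒ P} →
                 IsCoproduct C A P ι → ∀ {B D} {f : B ⇒ D} {g : P ⇒ D} →
                 (∀ i → Apart f (g ∘ ι i)) → Apart f g
  Apart-copair countable {ι = ι} P-isCoproduct {f = f} {g} apart y z fy≈gz =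
    coproduct-of-initials isCoproduct part-initial
    where
    open Decomposition (decompose countable P-isCoproduct z)
    part-initial : ∀ i → IsInitial C (part i)
    part-initial i = apart i (y ∘ p i) (q i) (begin
      f ∘ (y ∘ p i)      ≈⟨ pullˡ fy≈gz ⟩
      (g ∘ z) ∘ p i      ≈⟨ pullʳ (proj₁ (pullback i)) ⟩
      g ∘ (ι i ∘ q i)    ≈⟨ sym-assoc ⟩
      (g ∘ ι i) ∘ q i    ∎)

  record BinaryDecomposition {A₁ A₂ P B : Obj} (i₁ : A₁ ⇒ P) (i₂ : A₂ ⇒ P) (f : B ⇒ P)
                             : Set (o ⊔ ℓ ⊔ e) where
    field
      B₁ B₂       : Obj
      p₁          : B₁ ⇒ B
      p₂          : B₂ ⇒ B
      q₁          : B₁ ⇒ A₁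
      q₂          : B₂ ⇒ A₂
      pullback₁   : IsPullback C p₁ q₁ f i₁
      pullback₂   : IsPullback C p₂ q₂ f i₂
      isCoproduct : IsBinaryCoproduct B p₁ p₂

    commute₁ : f ∘ p₁ ≈ i₁ ∘ q₁
    commute₁ = proj₁ pullback₁

    commute₂ : f ∘ p₂ ≈ i₂ ∘ q₂
    commute₂ = proj₁ pullback₂

  decompose₂ : ∀ {A₁ A₂ P} {i₁ : A₁ ⇒ P} {i₂ : A₂ ⇒ P} → IsBinaryCoproduct P i₁ i₂ →
               ∀ {B} (f : B ⇒ P) → BinaryDecomposition i₁ i₂ f
  decompose₂ P-isCoproduct f = record
    { B₁ = part true ; B₂ = part false ; p₁ = p true ; p₂ = p false
    ; q₁ = q true ; q₂ = q false ; pullback₁ = pullback true ; pullback₂ = pullback false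
    ; isCoproduct = Bool-coproduct⇒binary isCoproduct
    }
    where open Decomposition (decompose Bool-countable P-isCoproduct f)

  factor-through-complement : ∀ {A₁ A₂ P B} {i₁ : A₁ ⇒ P} {i₂ : A₂ ⇒ P} →
                              IsBinaryCoproduct P i₁ i₂ → (f : B ⇒ P) → Apart f i₁ →
                              Σ (B ⇒ A₂) λ g → f ≈ i₂ ∘ g
  factor-through-complement {i₂ = i₂} P-isCoproduct f apart =
    copair (proj₁ (B₁-initial _)) q₂ ,
    unique′ (initial-≈ B₁-initial _ _) (begin
      f ∘ p₂                                        ≈⟨ commute₂ ⟩
      i₂ ∘ q₂                                       ≈⟨ refl⟩∘⟨ sym inject₂ ⟩
      i₂ ∘ (copair (proj₁ (B₁-initial _)) q₂ ∘ p₂)  ≈⟨ sym-assoc ⟩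
      (i₂ ∘ copair (proj₁ (B₁-initial _)) q₂) ∘ p₂  ∎)
    where
    open BinaryDecomposition (decompose₂ P-isCoproduct f)
    open BinaryCoproduct isCoproduct
    B₁-initial : IsInitial C B₁
    B₁-initial = apart p₁ q₁ commute₁

  infixr 6 _+_ _+₁_

  _+_ : Obj → Obj → Obj
  _+_ = D._+_ C HE

  ι₁ : ∀ {A B} → A ⇒ A + B
  ι₁ = D.ι₁ C HE

  ι₂ : ∀ {A B} → B ⇒ A + B
  ι₂ = D.ι₂ C HE

  [_,_] : ∀ {A B Z} → A ⇒ Z → B ⇒ Z → A + B ⇒ Z
  [_,_] = D.[_,_] C HE

  _+₁_ : ∀ {A B A′ B′} → A ⇒ A′ → B ⇒ B′ → A + B ⇒ A′ + B′
  _+₁_ = D._+₁_ C HE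

  module + {A B : Obj} = BinaryCoproduct (+-isCoproduct C HE {A} {B})

  []-resp-≈ : ∀ {A B Z} {f f′ : A ⇒ Z} {g g′ : B ⇒ Z} → f ≈ f′ → g ≈ g′ → [ f , g ] ≈ [ f′ , g′ ]
  []-resp-≈ f≈f′ g≈g′ = +.unique _ (trans +.inject₁ f≈f′) (trans +.inject₂ g≈g′)

  +₁-resp-≈ : ∀ {A B A′ B′} {f f′ : A ⇒ A′} {g g′ : B ⇒ B′} → f ≈ f′ → g ≈ g′ → f +₁ g ≈ f′ +₁ g′
  +₁-resp-≈ f≈f′ g≈g′ = []-resp-≈ (refl⟩∘⟨ f≈f′) (refl⟩∘⟨ g≈g′)

  []∘+₁ : ∀ {A B A′ B′ Z} {f : A ⇒ A′} {g : B ⇒ B′} {h : A′ ⇒ Z} {k : B′ ⇒ Z} →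
          [ h , k ] ∘ (f +₁ g) ≈ [ h ∘ f , k ∘ g ]
  []∘+₁ = +.unique _ (trans (pullʳ +.inject₁) (pullˡ +.inject₁))
                     (trans (pullʳ +.inject₂) (pullˡ +.inject₂))

  +₁∘+₁ : ∀ {A B A′ B′ A″ B″} {f : A ⇒ A′} {g : B ⇒ B′} {f′ : A′ ⇒ A″} {g′ : B′ ⇒ B″} →
          (f′ +₁ g′) ∘ (f +₁ g) ≈ (f′ ∘ f) +₁ (g′ ∘ g)
  +₁∘+₁ = trans []∘+₁ ([]-resp-≈ assoc assoc)

  coproduct-reassoc : ∀ {L R X P R′} {l : L ⇒ X} {r : R ⇒ X} {x : P ⇒ R} {y : R′ ⇒ R} →
                      IsBinaryCoproduct X l r → IsBinaryCoproduct R x y →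
                      IsBinaryCoproduct X [ l , r ∘ x ] (r ∘ y)
  coproduct-reassoc {X = X} {l = l} {r} {x} {y} X-coproduct R-coproduct {Z} f =
    h , commutes , unique
    where
    module X = BinaryCoproduct X-coproduct
    module R = BinaryCoproduct R-coproduct
    h : X ⇒ Z
    h = X.copair (f true ∘ ι₁) (R.copair (f true ∘ ι₂) (f false))
    commutes : ∀ b → h ∘ cocone2 C [ l , r ∘ x ] (r ∘ y) b ≈ f b
    commutes true  = +.unique′ (trans (pullʳ +.inject₁) X.inject₁)
                               (trans (pullʳ +.inject₂) (trans (pullˡ X.inject₂) R.inject₁))
    commutes false = trans (pullˡ X.inject₂) R.inject₂
    unique : ∀ k → (∀ b → k ∘ cocone2 C [ l , r ∘ x ] (r ∘ y) b ≈ f b) → k ≈ h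
    unique k eq = X.unique k
      (pull-through +.inject₁ (eq true))
      (R.unique (k ∘ r) (trans assoc (pull-through +.inject₂ (eq true))) (trans assoc (eq false)))

  IsCoproductInjection-∘ : ∀ {A B D} {f : B ⇒ D} {g : A ⇒ B} →
                           IsCoproductInjection C f → IsCoproductInjection C g →
                           IsCoproductInjection C (f ∘ g)
  IsCoproductInjection-∘ (_ , _ , f-coproduct) (_ , _ , g-coproduct) =
    _ , _ , binary-swap (coproduct-reassoc (binary-swap f-coproduct) (binary-swap g-coproduct))

  regroup : ∀ {B₁ B₂ B Y A} {b₁ : B₁ ⇒ B} {b₂ : B₂ ⇒ B} → IsBinaryCoproduct B b₁ b₂ →
            IsBinaryCoproduct ((B + Y) + A) [ ι₁ ∘ ι₁ ∘ b₁ , ι₂ ] [ ι₁ ∘ ι₁ ∘ b₂ , ι₁ ∘ ι₂ ]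
  regroup {B₁} {B₂} {B} {Y} {A} {b₁} {b₂} B-coproduct {Z} f = h , commutes , unique
    where
    module B = BinaryCoproduct B-coproduct
    u : B₁ + A ⇒ (B + Y) + A
    u = [ ι₁ ∘ ι₁ ∘ b₁ , ι₂ ]
    v : B₂ + Y ⇒ (B + Y) + A
    v = [ ι₁ ∘ ι₁ ∘ b₂ , ι₁ ∘ ι₂ ]
    h : (B + Y) + A ⇒ Z
    h = [ [ B.copair (f true ∘ ι₁) (f false ∘ ι₁) , f false ∘ ι₂ ] , f true ∘ ι₂ ]
    commutes : ∀ b → h ∘ cocone2 C u v b ≈ f b
    commutes true  = +.unique′
      (trans (pullʳ +.inject₁) (trans (pullˡ +.inject₁) (trans (pullˡ +.inject₁) B.inject₁)))
      (trans (pullʳ +.inject₂) +.inject₂)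
    commutes false = +.unique′
      (trans (pullʳ +.inject₁) (trans (pullˡ +.inject₁) (trans (pullˡ +.inject₁) B.inject₂)))
      (trans (pullʳ +.inject₂) (trans (pullˡ +.inject₁) +.inject₂))
    unique : ∀ k → (∀ b → k ∘ cocone2 C u v b ≈ f b) → k ≈ h
    unique k eq = +.unique k
      (+.unique (k ∘ ι₁)
        (B.unique ((k ∘ ι₁) ∘ ι₁)
          (trans assoc (trans assoc (pull-through {c = u} +.inject₁ (eq true))))
          (trans assoc (trans assoc (pull-through {c = v} +.inject₁ (eq false)))))
        (trans assoc (pull-through {c = v} +.inject₂ (eq false))))
      (pull-through {c = u} +.inject₂ (eq true))

module CiaConstruction {o ℓ e : Level} (C : Category o ℓ e) (HE : HyperExtensive C)
                       (H : Endofunctor C) (preserves : PreservesCountableCoproducts C H)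
                       (Y : Category.Obj C) where
  open Category C
  open HyperExtensive HE
  open CategoryReasoning C
  open Coproducts C
  open Extensive C HE
  module H = Endofunctor H

  H-binary : ∀ {A B P} {i : A ⇒ P} {j : B ⇒ P} → IsBinaryCoproduct P i j →
             IsBinaryCoproduct (H.F₀ P) (H.F₁ i) (H.F₁ j)
  H-binary isCoproduct = Bool-coproduct⇒binary (preserves Bool-countable isCoproduct)

  module Solution {A : Obj} (a : H.F₀ A + Y ⇒ A)
                  (corecursive : IsCorecursive C HE (_+K_ C HE H Y) a)
                  {X : Obj} (ε : X ⇒ (H.F₀ X + Y) + A) where

    -- Stage n splits X as L + R, where L consists of the points from which ε
    -- reaches A within n steps; the solution on L is already forced.
    record Stage : Set (o ⊔ ℓ ⊔ e) where
      field
        L R         : Obj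
        l           : L ⇒ X
        r           : R ⇒ X
        isCoproduct : IsBinaryCoproduct X l r
        solution    : L ⇒ A

    module Refine (stage : Stage) where
      open Stage stage

      towards-L : H.F₀ L + A ⇒ (H.F₀ X + Y) + A
      towards-L = [ ι₁ ∘ ι₁ ∘ H.F₁ l , ι₂ ]

      towards-R : H.F₀ R + Y ⇒ (H.F₀ X + Y) + A
      towards-R = [ ι₁ ∘ ι₁ ∘ H.F₁ r , ι₁ ∘ ι₂ ]

      decomposition : BinaryDecomposition towards-L towards-R (ε ∘ r)
      decomposition = decompose₂ (regroup (H-binary isCoproduct)) (ε ∘ r)

      open BinaryDecomposition decomposition public
        using (commute₁; pullback₁)
        renaming (B₁ to New; B₂ to Rest; p₁ to new; p₂ to rest; q₁ to new-step;
                  isCoproduct to R-isCoproduct)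

      new-solution : New ⇒ A
      new-solution = [ a ∘ ι₁ ∘ H.F₁ solution , id ] ∘ new-step

    next : Stage → Stage
    next stage = record
      { L = L + New ; R = Rest ; l = [ l , r ∘ new ] ; r = r ∘ rest
      ; isCoproduct = coproduct-reassoc isCoproduct R-isCoproduct
      ; solution = [ solution , new-solution ]
      }
      where
      open Stage stage
      open Refine stage

    stage : ℕ → Stage
    stage zero = record
      { L = 𝟘 ; R = X ; l = proj₁ (𝟘-isInitial X) ; r = id
      ; isCoproduct = initial-left-unit 𝟘-isInitial ; solution = proj₁ (𝟘-isInitial A)
      }
    stage (suc n) = next (stage n)

    open module Stages (n : ℕ) = Stage (stage n)
    open module Refinements (n : ℕ) = Refine (stage n)

    layer : ∀ n → New n ⇒ X
    layer n = r n ∘ new n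

    layer-via-L : ∀ n → l (suc n) ∘ ι₂ ≈ layer n
    layer-via-L n = +.inject₂

    r-factors : ∀ {n k} → n ≤′ k → Σ (R k ⇒ R n) λ c → r k ≈ r n ∘ c
    r-factors ≤′-refl = id , sym identityʳ
    r-factors (≤′-step {k} n≤k) =
      proj₁ (r-factors n≤k) ∘ rest k , trans (proj₂ (r-factors n≤k) ⟩∘⟨refl) assoc

    earlier-layer-apart : ∀ {n k} → n < k → Apart (layer n) (layer k)
    earlier-layer-apart {n} {k} n<k =
      Apart-∘ L-apart-R (layer-via-L n) (trans sym-assoc (sym (proj₂ r-k-factors) ⟩∘⟨refl))
      where
      L-apart-R : Apart (l (suc n)) (r (suc n))
      L-apart-R = Disjoint⇒Apart (disjoint Bool-countable (isCoproduct (suc n)) true false (λ ()))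
      r-k-factors : Σ (R k ⇒ R (suc n)) λ c → r k ≈ r (suc n) ∘ c
      r-k-factors = r-factors (≤⇒≤′ n<k)

    layers-apart : ∀ n k → n ≢ k → Apart (layer n) (layer k)
    layers-apart n k n≢k = by-trichotomy (<-cmp n k)
      where
      by-trichotomy : Tri (n < k) (n ≡ k) (k < n) → Apart (layer n) (layer k)
      by-trichotomy (tri< n<k _ _) = earlier-layer-apart n<k
      by-trichotomy (tri≈ _ n≡k _) = ⊥-elim (n≢k n≡k)
      by-trichotomy (tri> _ _ k<n) = Apart-sym (earlier-layer-apart k<n)

    layer-isInjection : ∀ n → IsCoproductInjection C (layer n)
    layer-isInjection n =
      IsCoproductInjection-∘ (_ , _ , binary-swap (isCoproduct n)) (_ , _ , R-isCoproduct n)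

    module ∐ = Coproduct (coproducts ℕ-countable New)

    layers : ∐.obj ⇒ X
    layers = proj₁ (∐.isCoproduct layer)

    layers-inject : ∀ n → layers ∘ ∐.inj n ≈ layer n
    layers-inject = proj₁ (proj₂ (∐.isCoproduct layer))

    towards-layers : H.F₀ ∐.obj + A ⇒ (H.F₀ X + Y) + A
    towards-layers = [ ι₁ ∘ ι₁ ∘ H.F₁ layers , ι₂ ]

    layer-settles-next : ∀ n → towards-L (suc n) ∘ (ι₁ ∘ H.F₁ ι₂) ≈
                               (towards-layers ∘ ι₁) ∘ H.F₁ (∐.inj n)
    layer-settles-next n = begin
      towards-L (suc n) ∘ (ι₁ ∘ H.F₁ ι₂)       ≈⟨ pullˡ +.inject₁ ⟩
      (ι₁ ∘ ι₁ ∘ H.F₁ (l (suc n))) ∘ H.F₁ ι₂    ≈⟨ pullʳ (pullʳ (sym H.homomorphism)) ⟩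
      ι₁ ∘ ι₁ ∘ H.F₁ (l (suc n) ∘ ι₂)           ≈⟨ refl⟩∘⟨ refl⟩∘⟨ H.F-resp-≈ same-layer ⟩
      ι₁ ∘ ι₁ ∘ H.F₁ (layers ∘ ∐.inj n)         ≈⟨ sym (pullʳ (pullʳ (sym H.homomorphism))) ⟩
      (ι₁ ∘ ι₁ ∘ H.F₁ layers) ∘ H.F₁ (∐.inj n)  ≈⟨ sym +.inject₁ ⟩∘⟨refl ⟩
      (towards-layers ∘ ι₁) ∘ H.F₁ (∐.inj n)    ∎
      where
      same-layer : l (suc n) ∘ ι₂ ≈ layers ∘ ∐.inj n
      same-layer = trans (layer-via-L n) (sym (layers-inject n))

    step-with : ∀ {Z} → Z ⇒ A → (H.F₀ Z + Y) + A ⇒ A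
    step-with t = [ a , id ] ∘ ((H.F₁ t +₁ id) +₁ id)

    Φ : X ⇒ A → X ⇒ A
    Φ t = [ a , id ] ∘ ((H.F₁ t +₁ id) +₁ id) ∘ ε

    step-with-ι₁ : ∀ {Z} (t : Z ⇒ A) → step-with t ∘ ι₁ ≈ a ∘ (H.F₁ t +₁ id)
    step-with-ι₁ t = trans (pullʳ +.inject₁) (pullˡ +.inject₁)

    step-with-settled : ∀ {Z W} (t : Z ⇒ A) (g : W ⇒ Z) →
                        step-with t ∘ [ ι₁ ∘ ι₁ ∘ H.F₁ g , ι₂ ] ≈ [ a ∘ ι₁ ∘ H.F₁ (t ∘ g) , id ]
    step-with-settled t g = +.unique _
      (begin
        (step-with t ∘ [ ι₁ ∘ ι₁ ∘ H.F₁ g , ι₂ ]) ∘ ι₁   ≈⟨ pullʳ +.inject₁ ⟩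
        step-with t ∘ ι₁ ∘ ι₁ ∘ H.F₁ g                   ≈⟨ pullˡ (step-with-ι₁ t) ⟩
        (a ∘ (H.F₁ t +₁ id)) ∘ ι₁ ∘ H.F₁ g               ≈⟨ pullʳ (pullˡ +.inject₁) ⟩
        a ∘ (ι₁ ∘ H.F₁ t) ∘ H.F₁ g                       ≈⟨ refl⟩∘⟨ pullʳ (sym H.homomorphism) ⟩
        a ∘ ι₁ ∘ H.F₁ (t ∘ g)                            ∎)
      (trans (pullʳ +.inject₂) (trans (pullʳ +.inject₂) (trans (pullˡ +.inject₂) identityˡ)))

    step-with-tail : ∀ {Z W} (t : Z ⇒ A) (g : W ⇒ Z) →
                     step-with t ∘ ι₁ ∘ (H.F₁ g +₁ id) ≈ a ∘ (H.F₁ (t ∘ g) +₁ id)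
    step-with-tail t g = begin
      step-with t ∘ ι₁ ∘ (H.F₁ g +₁ id)        ≈⟨ pullˡ (step-with-ι₁ t) ⟩
      (a ∘ (H.F₁ t +₁ id)) ∘ (H.F₁ g +₁ id)    ≈⟨ pullʳ +₁∘+₁ ⟩
      a ∘ ((H.F₁ t ∘ H.F₁ g) +₁ (id ∘ id))     ≈⟨ refl⟩∘⟨ +₁-resp-≈ (sym H.homomorphism) identityˡ ⟩
      a ∘ (H.F₁ (t ∘ g) +₁ id)                 ∎

    Φ-on-settled-layer : ∀ n (t : X ⇒ A) → t ∘ l n ≈ solution n → Φ t ∘ layer n ≈ new-solution n
    Φ-on-settled-layer n t tl≈solution = begin
      Φ t ∘ (r n ∘ new n)                                        ≈⟨ pullʳ (pullʳ sym-assoc) ⟩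
      [ a , id ] ∘ ((H.F₁ t +₁ id) +₁ id) ∘ ((ε ∘ r n) ∘ new n)  ≈⟨ refl⟩∘⟨ refl⟩∘⟨ commute₁ n ⟩
      [ a , id ] ∘ ((H.F₁ t +₁ id) +₁ id) ∘ towards-L n ∘ new-step n  ≈⟨ sym-assoc ⟩
      step-with t ∘ towards-L n ∘ new-step n                     ≈⟨ pullˡ (step-with-settled t (l n)) ⟩
      [ a ∘ ι₁ ∘ H.F₁ (t ∘ l n) , id ] ∘ new-step n              ≈⟨ on-L ⟩∘⟨refl ⟩
      new-solution n                                             ∎
      where
      on-L : [ a ∘ ι₁ ∘ H.F₁ (t ∘ l n) , id ] ≈ [ a ∘ ι₁ ∘ H.F₁ (solution n) , id ]
      on-L = []-resp-≈ (refl⟩∘⟨ refl⟩∘⟨ H.F-resp-≈ tl≈solution) refl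

    settled-on-stages : (t : X ⇒ A) → (∀ n → t ∘ l n ≈ solution n → t ∘ layer n ≈ new-solution n) →
                        ∀ n → t ∘ l n ≈ solution n
    settled-on-stages t extends zero    = initial-≈ 𝟘-isInitial _ _
    settled-on-stages t extends (suc n) = +.unique′
      (trans (pullʳ +.inject₁) (trans tl≈solution (sym +.inject₁)))
      (trans (pullʳ +.inject₂) (trans (extends n tl≈solution) (sym +.inject₂)))
      where tl≈solution = settled-on-stages t extends n

    solution-extends : (t : X ⇒ A) → t ≈ Φ t →
                       ∀ n → t ∘ l n ≈ solution n → t ∘ layer n ≈ new-solution n
    solution-extends t t≈Φt n tl≈solution =
      trans (t≈Φt ⟩∘⟨refl) (Φ-on-settled-layer n t tl≈solution)

    module Tail {X∞ : Obj} {ι∞ : X∞ ⇒ X} (X-isCoproduct : IsBinaryCoproduct X layers ι∞) where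

      layer-apart-tail : ∀ n → Apart (layer n) ι∞
      layer-apart-tail n =
        Apart-∘ (Disjoint⇒Apart (disjoint Bool-countable X-isCoproduct true false (λ ())))
                (layers-inject n) identityʳ

      tail-in-next-R : ∀ n (k : X∞ ⇒ R n) → r n ∘ k ≈ ι∞ →
                       Σ (X∞ ⇒ R (suc n)) λ k′ → r (suc n) ∘ k′ ≈ ι∞
      tail-in-next-R n k rk≈ι∞ = proj₁ k-factors , (begin
        (r n ∘ rest n) ∘ proj₁ k-factors   ≈⟨ pullʳ (sym (proj₂ k-factors)) ⟩
        r n ∘ k                            ≈⟨ rk≈ι∞ ⟩
        ι∞                                 ∎)
        where
        k-apart-new : Apart k (new n)
        k-apart-new y z ky≈newz = layer-apart-tail n z y (begin
          (r n ∘ new n) ∘ z   ≈⟨ pullʳ (sym ky≈newz) ⟩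
          r n ∘ (k ∘ y)       ≈⟨ pullˡ rk≈ι∞ ⟩
          ι∞ ∘ y              ∎)
        k-factors : Σ (X∞ ⇒ Rest n) λ k′ → k ≈ rest n ∘ k′
        k-factors = factor-through-complement (R-isCoproduct n) k k-apart-new

      tail-in-R : ∀ n → Σ (X∞ ⇒ R n) λ k → r n ∘ k ≈ ι∞
      tail-in-R zero    = ι∞ , identityˡ
      tail-in-R (suc n) = tail-in-next-R n (proj₁ (tail-in-R n)) (proj₂ (tail-in-R n))

      tail-never-settles : ∀ n → Apart (ε ∘ ι∞) (towards-L n)
      tail-never-settles n {Q} y z square = layer-apart-tail n w y (begin
        (r n ∘ new n) ∘ w   ≈⟨ pullʳ new∘w≈k∘y ⟩
        r n ∘ (k ∘ y)       ≈⟨ pullˡ rk≈ι∞ ⟩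
        ι∞ ∘ y              ∎)
        where
        k : X∞ ⇒ R n
        k = proj₁ (tail-in-R n)
        rk≈ι∞ : r n ∘ k ≈ ι∞
        rk≈ι∞ = proj₂ (tail-in-R n)
        lands-in-L : (ε ∘ r n) ∘ (k ∘ y) ≈ towards-L n ∘ z
        lands-in-L = begin
          (ε ∘ r n) ∘ (k ∘ y)   ≈⟨ pullʳ (pullˡ rk≈ι∞) ⟩
          ε ∘ (ι∞ ∘ y)          ≈⟨ sym-assoc ⟩
          (ε ∘ ι∞) ∘ y          ≈⟨ square ⟩
          towards-L n ∘ z       ∎
        w : Q ⇒ New n
        w = proj₁ (proj₂ (pullback₁ n) (k ∘ y) z lands-in-L)
        new∘w≈k∘y : new n ∘ w ≈ k ∘ y
        new∘w≈k∘y = proj₁ (proj₂ (proj₂ (pullback₁ n) (k ∘ y) z lands-in-L))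

      tail-never-settles-anywhere : Apart (ε ∘ ι∞) towards-layers
      tail-never-settles-anywhere =
        Apart-copair Bool-countable (+-isCoproduct C HE) by-summand
        where
        by-layer : ∀ n → Apart (ε ∘ ι∞) ((towards-layers ∘ ι₁) ∘ H.F₁ (∐.inj n))
        by-layer n = Apart-∘ (tail-never-settles (suc n)) identityʳ (layer-settles-next n)
        by-summand : ∀ b → Apart (ε ∘ ι∞) (towards-layers ∘ cocone2 C ι₁ ι₂ b)
        by-summand true  = Apart-copair ℕ-countable (preserves ℕ-countable ∐.isCoproduct) by-layer
        by-summand false =
          Apart-∘ (tail-never-settles 0) identityʳ (trans +.inject₂ (sym +.inject₂))

      tail-factors : Σ (X∞ ⇒ H.F₀ X∞ + Y) λ g → ε ∘ ι∞ ≈ [ ι₁ ∘ ι₁ ∘ H.F₁ ι∞ , ι₁ ∘ ι₂ ] ∘ g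
      tail-factors = factor-through-complement
        (regroup (H-binary X-isCoproduct)) (ε ∘ ι∞) tail-never-settles-anywhere

      ε∞ : X∞ ⇒ H.F₀ X∞ + Y
      ε∞ = proj₁ tail-factors

      tail-coalgebra : ε ∘ ι∞ ≈ ι₁ ∘ (H.F₁ ι∞ +₁ id) ∘ ε∞
      tail-coalgebra = trans (proj₂ tail-factors) (trans (into-left ⟩∘⟨refl) assoc)
        where
        into-left : [ ι₁ ∘ ι₁ ∘ H.F₁ ι∞ , ι₁ ∘ ι₂ ] ≈ ι₁ ∘ (H.F₁ ι∞ +₁ id)
        into-left = +.unique′ (trans +.inject₁ (sym (pullʳ +.inject₁)))
                              (trans +.inject₂ (sym (trans (pullʳ +.inject₂) (refl⟩∘⟨ identityʳ))))


      Φ-on-tail : ∀ (t : X ⇒ A) → Φ t ∘ ι∞ ≈ a ∘ (H.F₁ (t ∘ ι∞) +₁ id) ∘ ε∞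
      Φ-on-tail t = begin
        Φ t ∘ ι∞
          ≈⟨ pullʳ (pullʳ tail-coalgebra) ⟩
        [ a , id ] ∘ ((H.F₁ t +₁ id) +₁ id) ∘ ι₁ ∘ (H.F₁ ι∞ +₁ id) ∘ ε∞
          ≈⟨ trans sym-assoc (refl⟩∘⟨ sym-assoc) ⟩
        step-with t ∘ (ι₁ ∘ (H.F₁ ι∞ +₁ id)) ∘ ε∞
          ≈⟨ pullˡ (step-with-tail t ι∞) ⟩
        (a ∘ (H.F₁ (t ∘ ι∞) +₁ id)) ∘ ε∞
          ≈⟨ assoc ⟩
        a ∘ (H.F₁ (t ∘ ι∞) +₁ id) ∘ ε∞
          ∎

      module X = BinaryCoproduct X-isCoproduct

      X-ext : ∀ {Z} {f g : X ⇒ Z} → (∀ n → f ∘ layer n ≈ g ∘ layer n) → f ∘ ι∞ ≈ g ∘ ι∞ → f ≈ g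
      X-ext {f = f} {g} on-layers on-tail = X.unique′ (coproduct-ext ∐.isCoproduct on-inj) on-tail
        where
        on-inj : ∀ n → (f ∘ layers) ∘ ∐.inj n ≈ (g ∘ layers) ∘ ∐.inj n
        on-inj n = begin
          (f ∘ layers) ∘ ∐.inj n   ≈⟨ pullʳ (layers-inject n) ⟩
          f ∘ layer n              ≈⟨ on-layers n ⟩
          g ∘ layer n              ≈⟨ sym (pullʳ (layers-inject n)) ⟩
          (g ∘ layers) ∘ ∐.inj n   ∎

      solution∞ : X∞ ⇒ A
      solution∞ = proj₁ (corecursive ε∞)

      layered-solution : ∐.obj ⇒ A
      layered-solution = proj₁ (∐.isCoproduct new-solution)

      ε† : X ⇒ A
      ε† = X.copair layered-solution solution∞

      ε†-on-layer : ∀ n → ε† ∘ layer n ≈ new-solution n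
      ε†-on-layer n = begin
        ε† ∘ layer n                    ≈⟨ refl⟩∘⟨ sym (layers-inject n) ⟩
        ε† ∘ layers ∘ ∐.inj n           ≈⟨ pullˡ X.inject₁ ⟩
        layered-solution ∘ ∐.inj n      ≈⟨ proj₁ (proj₂ (∐.isCoproduct new-solution)) n ⟩
        new-solution n                  ∎

      ε†-solves : ε† ≈ Φ ε†
      ε†-solves = X-ext on-layer on-tail
        where
        on-layer : ∀ n → ε† ∘ layer n ≈ Φ ε† ∘ layer n
        on-layer n = trans (ε†-on-layer n) (sym (Φ-on-settled-layer n ε†
                       (settled-on-stages ε† (λ m _ → ε†-on-layer m) n)))
        tail≈ : solution∞ ≈ ε† ∘ ι∞
        tail≈ = sym X.inject₂
        on-tail : ε† ∘ ι∞ ≈ Φ ε† ∘ ι∞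
        on-tail = begin
          ε† ∘ ι∞                            ≈⟨ X.inject₂ ⟩
          solution∞                          ≈⟨ proj₁ (proj₂ (corecursive ε∞)) ⟩
          a ∘ (H.F₁ solution∞ +₁ id) ∘ ε∞    ≈⟨ refl⟩∘⟨ (+₁-resp-≈ (H.F-resp-≈ tail≈) refl ⟩∘⟨refl) ⟩
          a ∘ (H.F₁ (ε† ∘ ι∞) +₁ id) ∘ ε∞    ≈⟨ sym (Φ-on-tail ε†) ⟩
          Φ ε† ∘ ι∞                          ∎

      ε†-unique : ∀ (t : X ⇒ A) → t ≈ Φ t → t ≈ ε†
      ε†-unique t t≈Φt = X-ext on-layer on-tail
        where
        on-stages : ∀ n → t ∘ l n ≈ solution n
        on-stages = settled-on-stages t (solution-extends t t≈Φt)
        on-layer : ∀ n → t ∘ layer n ≈ ε† ∘ layer n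
        on-layer n = trans (solution-extends t t≈Φt n (on-stages n)) (sym (ε†-on-layer n))
        tail-solves : t ∘ ι∞ ≈ a ∘ (H.F₁ (t ∘ ι∞) +₁ id) ∘ ε∞
        tail-solves = trans (t≈Φt ⟩∘⟨refl) (Φ-on-tail t)
        on-tail : t ∘ ι∞ ≈ ε† ∘ ι∞
        on-tail = trans (proj₂ (proj₂ (corecursive ε∞)) (t ∘ ι∞) tail-solves) (sym X.inject₂)

    layers-complemented : IsCoproductInjection C layers
    layers-complemented = coherent ℕ-countable layer layer-isInjection
                            (λ n k n≢k → Apart⇒Disjoint (layers-apart n k n≢k)) ∐.isCoproduct

    unique-solution : Σ (X ⇒ A) λ s → (s ≈ Φ s) × (∀ t → t ≈ Φ t → t ≈ s)
    unique-solution = ε† , ε†-solves , ε†-unique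
      where open Tail (proj₂ (proj₂ layers-complemented))

  +K-isCiaFunctor : IsCiaFunctor C HE (_+K_ C HE H Y)
  +K-isCiaFunctor a corecursive ε = Solution.unique-solution a corecursive ε

corollary4p7 : ∀ {o ℓ e : Level} (C : Category o ℓ e) (HE : HyperExtensive C)
    (H : Endofunctor C) → HasTerminalCoalgebra C H →
    PreservesCountableCoproducts C H →
    (Y : Category.Obj C) → IsCiaFunctor C HE (_+K_ C HE H Y)
corollary4p7 C HE H _ preserves Y = CiaConstruction.+K-isCiaFunctor C HE H preserves Y
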